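{- Let $G$ be a violation subgraph of $f:[n]^d\to\{0,1\}$ and let $H_1,\dots,H_k$ be violation subgraphs whose edge sets partition the edge set of $G$. Then $\sum_{j\le k}\mathrm{Tal}(H_j)\ge\mathrm{Tal}(G)$.
   Context: A violation subgraph $G=(\boldsymbol{X},\boldsymbol{Y},E)$: $E$ is a set of pairs $(\mathbf{x},\mathbf{y})$ of points of $[n]^d$ with $\mathbf{x}\prec\mathbf{y}$ (coordinatewise) differing in exactly one coordinate $i$ (an $i$-edge), with $f(\mathbf{x})=1$ and $f(\mathbf{y})=0$; $\boldsymbol{X}$ and $\boldsymbol{Y}$ are the sets of lower and upper endpoints. For a coloring $\chi:E\to\{0,1\}$ and vertex $\mathbf{z}$, $\Phi_{G,\chi}(\mathbf{z})$ is the number of coordinates $i\in[d]$ for which some $i$-edge $e\in E$ incident to $\mathbf{z}$ has $\chi(e)=f(\mathbf{z})$. $\mathrm{Tal}(G)=\min_{\chi:E\to\{0,1\}}\sum_{\mathbf{z}\in\boldsymbol{X}\cup\boldsymbol{Y}}\sqrt{\Phi_{G,\chi}(\mathbf{z})}$. -}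

module Defs where

open import Data.Nat using (ℕ; zero; suc; _+_; _*_; _≤_; _≤ᵇ_)
open import Data.Bool using (Bool; true; false; if_then_else_)
import Data.Bool.Properties as BoolP
open import Data.Fin using (Fin) renaming (_<_ to _<ᶠ_)
import Data.Fin.Properties as FinP
open import Data.Vec using (Vec; lookup)
import Data.Vec.Properties as VecP
open import Data.Nat.ListAction using (sum)
open import Data.List using (List; []; _∷_; map; length; filter; deduplicate; concat; allFin)
open import Data.List.Relation.Unary.All using (All)
open import Data.List.Relation.Unary.Unique.Propositional using (Unique)
open import Data.Product using (Σ; _×_; _,_; proj₁; proj₂)
open import Relation.Binary.PropositionalEquality using (_≡_; _≢_)
open import Relation.Nullary.Decidable using (⌊_⌋; ¬?)
open import Relation.Binary.Definitions using (DecidableEquality)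

Point : ℕ → ℕ → Set
Point n d = Vec (Fin n) d

_≟ₚ_ : ∀ {n d} → DecidableEquality (Point n d)
_≟ₚ_ = VecP.≡-dec FinP._≟_

-- An edge is an ordered pair (x , y) (lower endpoint, upper endpoint).
Edge : ℕ → ℕ → Set
Edge n d = Point n d × Point n d

IsIEdge : ∀ {n d} → Fin d → Edge n d → Set
IsIEdge i (x , y) = (lookup x i <ᶠ lookup y i) × (∀ j → j ≢ i → lookup x j ≡ lookup y j)

IsEdge : ∀ {n d} → Edge n d → Set
IsEdge {d = d} e = Σ (Fin d) λ i → IsIEdge i e

-- f : [n]^d → {0,1}, with 1 = true, 0 = false.
-- A violation subgraph is given by its (finite, duplicate-free) edge set E;
-- X and Y are the sets of lower/upper endpoints of edges of E.
IsViolationGraph : ∀ {n d} → (Point n d → Bool) → List (Edge n d) → Set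
IsViolationGraph f E =
  Unique E × All (λ e → IsEdge e × (f (proj₁ e) ≡ true) × (f (proj₂ e) ≡ false)) E

vertices : ∀ {n d} → List (Edge n d) → List (Point n d)
vertices [] = []
vertices ((x , y) ∷ E) = x ∷ y ∷ vertices E

vertexSet : ∀ {n d} → List (Edge n d) → List (Point n d)
vertexSet E = deduplicate _≟ₚ_ (vertices E)

-- Colorings χ : E → {0,1} (given as functions on all pairs; only values on E matter).
Coloring : ℕ → ℕ → Set
Coloring n d = Edge n d → Bool

-- Boolean tests. For edges of a violation subgraph (which differ in exactly
-- one coordinate), e is an i-edge iff its endpoints differ at coordinate i.
isIEdgeᵇ : ∀ {n d} → Fin d → Edge n d → Bool
isIEdgeᵇ i (x , y) = ⌊ ¬? (lookup x i FinP.≟ lookup y i) ⌋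

incidentᵇ : ∀ {n d} → Point n d → Edge n d → Bool
incidentᵇ z (x , y) with ⌊ z ≟ₚ x ⌋
... | true = true
... | false = ⌊ z ≟ₚ y ⌋

anyᵇ : ∀ {A : Set} → (A → Bool) → List A → Bool
anyᵇ p [] = false
anyᵇ p (a ∷ as) = if p a then true else anyᵇ p as

countᵇ : ∀ {A : Set} → (A → Bool) → List A → ℕ
countᵇ p as = length (filter (λ a → p a BoolP.≟ true) as)

Φ : ∀ {n d} → (Point n d → Bool) → List (Edge n d) → Coloring n d → Point n d → ℕ
Φ {d = d} f E χ z =
  countᵇ (λ i → anyᵇ (λ e → if isIEdgeᵇ i e then
                                (if incidentᵇ z e then ⌊ χ e BoolP.≟ f z ⌋ else false)
                              else false) E)
         (allFin d)

-- The multiset of values Φ_{G,χ}(z), z ∈ X ∪ Y; the Talagrand objective for χ is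
-- the sum of their square roots.
phiList : ∀ {n d} → (Point n d → Bool) → List (Edge n d) → Coloring n d → List ℕ
phiList f E χ = map (Φ f E χ) (vertexSet E)

floorSqrt : ℕ → ℕ
floorSqrt m = go m
  where
  go : ℕ → ℕ
  go zero = zero
  go (suc r) = if (suc r * suc r) ≤ᵇ m then suc r else go r

-- Exact real comparison  Σ_{a∈A} √a ≤ Σ_{b∈B} √b  for lists of naturals,
-- expressed without reals: for every N,
--   Σ_a ⌊√(N²a)⌋ ≤ Σ_b ⌊√(N²b)⌋ + |B|.
-- (Equivalent since N√x - 1 < ⌊√(N²x)⌋ ≤ N√x.)
scaledSqrtSum : ℕ → List ℕ → ℕ
scaledSqrtSum N as = sum (map (λ a → floorSqrt (N * N * a)) as)

SqrtSum≤ : List ℕ → List ℕ → Set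
SqrtSum≤ A B = ∀ N → scaledSqrtSum N A ≤ scaledSqrtSum N B + length B

-- Glue the colourings: each edge of E gets the colour it has in the first H_j containing it.
-- Every coordinate counted in Φ_{G,χ}(z) is then witnessed by an edge of some H_j of the same
-- colour, so Φ_{G,χ}(z) ≤ Σ_j Φ_{H_j,χ_j}(z), and only those H_j having z as a vertex contribute.
-- Subadditivity √(Σ_j a_j) ≤ Σ_j √a_j, summed over the (distinct) vertices of G, gives the claim.
-- In the floor arithmetic of SqrtSum≤ one only has ⌊N√(a+b)⌋ ≤ ⌊N√a⌋ + 1 + ⌊N√b⌋, so every
-- non-zero summand costs an extra 1 (scaledSqrt⁺); the slack |B| pays for it.

module Submission where

open import Defs
open import Data.Nat using (ℕ; zero; suc; _+_; _*_; _≤_; _<_; _≤ᵇ_; z≤n)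
open import Data.Nat.Properties
open import Data.Nat.ListAction using (sum)
open import Data.Nat.ListAction.Properties using (sum-++; sum-↭)
open import Data.Bool using (Bool; true; false; if_then_else_; T)
import Data.Bool.Properties as BoolP
open import Data.Bool.Properties using (T-≡)
open import Data.Unit using (tt)
open import Data.Fin as Fin using (Fin; zero; suc)
open import Data.Fin.Properties using (any?)
open import Data.List using (List; []; _∷_; _++_; [_]; map; length; concat; tabulate; allFin)
open import Data.List.Properties using (map-∘; map-++)
open import Data.List.Relation.Unary.Any using (Any; here; there; satisfied)
open import Data.List.Relation.Unary.Any.Properties using (tabulate⁻)
import Data.List.Relation.Unary.All as All
open import Data.List.Relation.Unary.AllPairs using (_∷_)
open import Data.List.Relation.Unary.Unique.Propositional using (Unique)
open import Data.List.Relation.Unary.Unique.DecPropositional.Properties using (deduplicate-!)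
open import Data.List.Membership.Propositional using (_∈_; find; lose)
open import Data.List.Membership.Propositional.Properties using (∈-∃++; ∈-concat⁻; ∈-deduplicate⁺)
import Data.List.Membership.DecPropositional as DecMembership
open import Data.List.Relation.Binary.Permutation.Propositional using (_↭_)
open import Data.List.Relation.Binary.Permutation.Propositional.Properties using (∈-resp-↭; shift; map⁺)
open import Data.Product using (Σ; ∃; _×_; _,_)
import Data.Product.Properties as ProdP
open import Function using (_∘_; Equivalence)
open Equivalence using (to; from)
open import Relation.Nullary using (Dec; yes; no; contradiction)
open import Relation.Nullary.Decidable using (⌊_⌋)
open import Relation.Binary.PropositionalEquality
  using (_≡_; _≢_; refl; sym; trans; cong; subst; module ≡-Reasoning)
open import Algebra.Properties.CommutativeMonoid.Sum +-0-commutativeMonoid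
  using (sum-syntax; sum-cong-≗; ∑-distrib-+; sum-replicate-zero)

-- The local worker go of floorSqrt cannot be named; abstracting suc m below lets
-- unification solve this meta with it, after which its clauses hold definitionally.
mutual
  floorSqrtBelow : ℕ → ℕ → ℕ
  floorSqrtBelow = _

  private
    floorSqrt-suc : ∀ m →
      floorSqrt (suc m) ≡ (if suc m * suc m ≤ᵇ suc m then suc m else floorSqrtBelow (suc m) m)
    floorSqrt-suc m with suc m
    ... | w = refl

floorSqrt≡floorSqrtBelow : ∀ m → floorSqrt m ≡ floorSqrtBelow m m
floorSqrt≡floorSqrtBelow zero = refl
floorSqrt≡floorSqrtBelow (suc m) = floorSqrt-suc m

floorSqrtBelow-sq≤ : ∀ m r → floorSqrtBelow m r * floorSqrtBelow m r ≤ m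
floorSqrtBelow-sq≤ m zero = z≤n
floorSqrtBelow-sq≤ m (suc r) with suc r * suc r ≤ᵇ m in fits
... | true = ≤ᵇ⇒≤ _ m (from T-≡ fits)
... | false = floorSqrtBelow-sq≤ m r

<-floorSqrtBelow : ∀ m r → m < suc r * suc r →
  m < suc (floorSqrtBelow m r) * suc (floorSqrtBelow m r)
<-floorSqrtBelow m zero m<1 = m<1
<-floorSqrtBelow m (suc r) m<r² with suc r * suc r ≤ᵇ m in fits
... | true = m<r²
... | false = <-floorSqrtBelow m r (≰⇒> (subst T fits ∘ ≤⇒≤ᵇ))

floorSqrt-sq≤ : ∀ m → floorSqrt m * floorSqrt m ≤ m
floorSqrt-sq≤ m rewrite floorSqrt≡floorSqrtBelow m = floorSqrtBelow-sq≤ m m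

<-suc-floorSqrt-sq : ∀ m → m < suc (floorSqrt m) * suc (floorSqrt m)
<-suc-floorSqrt-sq m rewrite floorSqrt≡floorSqrtBelow m =
  <-floorSqrtBelow m m (<-≤-trans (n<1+n m) (m≤m*n (suc m) (suc m)))

sq≤⇒≤floorSqrt : ∀ {r m} → r * r ≤ m → r ≤ floorSqrt m
sq≤⇒≤floorSqrt {r} {m} r²≤m = ≮⇒≥ λ s<r →
  <-irrefl refl (<-≤-trans (<-suc-floorSqrt-sq m) (≤-trans (*-mono-≤ s<r s<r) r²≤m))

<sq⇒floorSqrt< : ∀ {m t} → m < t * t → floorSqrt m < t
<sq⇒floorSqrt< {m} m<t² = ≰⇒> λ t≤s →
  <-irrefl refl (<-≤-trans m<t² (≤-trans (*-mono-≤ t≤s t≤s) (floorSqrt-sq≤ m)))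

floorSqrt-mono-≤ : ∀ {x y} → x ≤ y → floorSqrt x ≤ floorSqrt y
floorSqrt-mono-≤ {x} x≤y = sq≤⇒≤floorSqrt (≤-trans (floorSqrt-sq≤ x) x≤y)

m*m+n*n≤[m+n]*[m+n] : ∀ m n → m * m + n * n ≤ (m + n) * (m + n)
m*m+n*n≤[m+n]*[m+n] m n rewrite *-distribʳ-+ (m + n) m n =
  +-mono-≤ (*-monoʳ-≤ m (m≤m+n m n)) (*-monoʳ-≤ n (m≤n+m n m))

floorSqrt-+ : ∀ x y → floorSqrt (x + y) < suc (floorSqrt x) + suc (floorSqrt y)
floorSqrt-+ x y = <sq⇒floorSqrt< (begin-strict
  x + y                         <⟨ +-mono-< (<-suc-floorSqrt-sq x) (<-suc-floorSqrt-sq y) ⟩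
  suc p * suc p + suc q * suc q ≤⟨ m*m+n*n≤[m+n]*[m+n] (suc p) (suc q) ⟩
  (suc p + suc q) * (suc p + suc q) ∎)
  where
  open ≤-Reasoning
  p = floorSqrt x
  q = floorSqrt y

scaledSqrt : ℕ → ℕ → ℕ
scaledSqrt N a = floorSqrt (N * N * a)

scaledSqrt⁺ : ℕ → ℕ → ℕ
scaledSqrt⁺ N zero = zero
scaledSqrt⁺ N a@(suc _) = suc (scaledSqrt N a)

scaledSqrt-mono-≤ : ∀ N {a b} → a ≤ b → scaledSqrt N a ≤ scaledSqrt N b
scaledSqrt-mono-≤ N a≤b = floorSqrt-mono-≤ (*-monoʳ-≤ (N * N) a≤b)

scaledSqrt⁺≤suc : ∀ N a → scaledSqrt⁺ N a ≤ suc (scaledSqrt N a)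
scaledSqrt⁺≤suc N zero = z≤n
scaledSqrt⁺≤suc N (suc a) = ≤-refl

scaledSqrt-+ : ∀ N a b → scaledSqrt N (a + b) ≤ scaledSqrt⁺ N a + scaledSqrt N b
scaledSqrt-+ N zero b = ≤-refl
scaledSqrt-+ N a@(suc _) b rewrite *-distribˡ-+ (N * N) a b =
  ≤-trans (≤-pred (floorSqrt-+ (N * N * a) (N * N * b)))
          (≤-reflexive (+-suc (scaledSqrt N a) (scaledSqrt N b)))

scaledSqrt-∑ : ∀ N {k} (c : Fin k → ℕ) →
  scaledSqrt N (∑[ j < k ] c j) ≤ ∑[ j < k ] scaledSqrt⁺ N (c j)
scaledSqrt-∑ N {zero} c = ≤-reflexive (cong floorSqrt (*-zeroʳ (N * N)))
scaledSqrt-∑ N {suc k} c =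
  ≤-trans (scaledSqrt-+ N (c zero) _) (+-monoʳ-≤ _ (scaledSqrt-∑ N (c ∘ suc)))

∑-mono-≤ : ∀ {k} {F G : Fin k → ℕ} → (∀ j → F j ≤ G j) → ∑[ j < k ] F j ≤ ∑[ j < k ] G j
∑-mono-≤ {zero} F≤G = z≤n
∑-mono-≤ {suc k} F≤G = +-mono-≤ (F≤G zero) (∑-mono-≤ (F≤G ∘ suc))

term≤∑ : ∀ {k} (F : Fin k → ℕ) j → F j ≤ ∑[ i < k ] F i
term≤∑ F zero = m≤m+n _ _
term≤∑ F (suc j) = ≤-trans (term≤∑ (F ∘ suc) j) (m≤n+m _ _)

module _ {A : Set} where

  sum-map-mono-≤ : ∀ {g h : A → ℕ} → (∀ x → g x ≤ h x) → ∀ xs → sum (map g xs) ≤ sum (map h xs)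
  sum-map-mono-≤ g≤h [] = z≤n
  sum-map-mono-≤ g≤h (x ∷ xs) = +-mono-≤ (g≤h x) (sum-map-mono-≤ g≤h xs)

  sum-map-suc : ∀ (h : A → ℕ) xs → sum (map (suc ∘ h) xs) ≡ sum (map h xs) + length xs
  sum-map-suc h [] = refl
  sum-map-suc h (x ∷ xs) = begin
    suc (h x + sum (map (suc ∘ h) xs))   ≡⟨ cong (λ s → suc (h x + s)) (sum-map-suc h xs) ⟩
    suc (h x + (sum (map h xs) + length xs)) ≡⟨ cong suc (+-assoc (h x) _ _) ⟨
    suc (h x + sum (map h xs) + length xs)   ≡⟨ +-suc _ (length xs) ⟨
    h x + sum (map h xs) + suc (length xs) ∎
    where open ≡-Reasoning

  sum-map-∑ : ∀ {k} (F : Fin k → A → ℕ) xs →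
    sum (map (λ x → ∑[ j < k ] F j x) xs) ≡ ∑[ j < k ] sum (map (F j) xs)
  sum-map-∑ {k} F [] = sym (sum-replicate-zero k)
  sum-map-∑ {k} F (x ∷ xs) =
    trans (cong (∑[ j < k ] F j x +_) (sum-map-∑ F xs)) (sym (∑-distrib-+ (λ j → F j x) _))

  sum-map-concat-tabulate : ∀ (h : A → ℕ) {k} (xss : Fin k → List A) →
    sum (map h (concat (tabulate xss))) ≡ ∑[ j < k ] sum (map h (xss j))
  sum-map-concat-tabulate h {zero} xss = refl
  sum-map-concat-tabulate h {suc k} xss = begin
    sum (map h (xss zero ++ rest))            ≡⟨ cong sum (map-++ h (xss zero) rest) ⟩
    sum (map h (xss zero) ++ map h rest)      ≡⟨ sum-++ (map h (xss zero)) (map h rest) ⟩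
    sum (map h (xss zero)) + sum (map h rest)
      ≡⟨ cong (sum (map h (xss zero)) +_) (sum-map-concat-tabulate h (xss ∘ Fin.suc)) ⟩
    sum (map h (xss zero)) + ∑[ j < k ] sum (map h (xss (Fin.suc j))) ∎
    where
    open ≡-Reasoning
    rest = concat (tabulate (xss ∘ Fin.suc))

  sum-map-≤-unique : ∀ (h : A → ℕ) {xs ys : List A} → Unique xs →
    (∀ {x} → x ∈ xs → h x ≢ 0 → x ∈ ys) → sum (map h xs) ≤ sum (map h ys)
  sum-map-≤-unique h {[]} _ _ = z≤n
  sum-map-≤-unique h {x ∷ xs} (x∉xs ∷ unique) support with h x ≟ 0
  ... | yes hx≡0 = ≤-trans (≤-reflexive (cong (_+ sum (map h xs)) hx≡0))
                           (sum-map-≤-unique h unique (support ∘ there))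
  ... | no hx≢0 with ∈-∃++ (support (here refl) hx≢0)
  ...   | P , Q , refl = begin
    h x + sum (map h xs)             ≤⟨ +-monoʳ-≤ (h x) (sum-map-≤-unique h unique support′) ⟩
    h x + sum (map h (P ++ Q))       ≡⟨ sum-↭ (map⁺ h (shift x P Q)) ⟨
    sum (map h (P ++ [ x ] ++ Q))    ∎
    where
    open ≤-Reasoning
    support′ : ∀ {y} → y ∈ xs → h y ≢ 0 → y ∈ P ++ Q
    support′ y∈xs hy≢0 with ∈-resp-↭ (shift x P Q) (support (there y∈xs) hy≢0)
    ... | here refl = contradiction refl (All.lookup x∉xs y∈xs)
    ... | there y∈P++Q = y∈P++Q

module _ {A : Set} where

  anyᵇ⇒Any : ∀ (p : A → Bool) xs → T (anyᵇ p xs) → Any (T ∘ p) xs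
  anyᵇ⇒Any p (x ∷ xs) h with p x in px
  ... | true = here (from T-≡ px)
  ... | false = there (anyᵇ⇒Any p xs h)

  Any⇒anyᵇ : ∀ (p : A → Bool) {xs} → Any (T ∘ p) xs → T (anyᵇ p xs)
  Any⇒anyᵇ p {x ∷ xs} (here px) with p x
  ... | true = tt
  Any⇒anyᵇ p {x ∷ xs} (there h) with p x
  ... | true = tt
  ... | false = Any⇒anyᵇ p h

  countᵇ-∷ : ∀ (p : A → Bool) x xs → countᵇ p (x ∷ xs) ≡ (if p x then 1 else 0) + countᵇ p xs
  countᵇ-∷ p x xs with p x
  ... | true = refl
  ... | false = refl

  countᵇ≢0⇒Any : ∀ (p : A → Bool) xs → countᵇ p xs ≢ 0 → Any (T ∘ p) xs
  countᵇ≢0⇒Any p [] c≢0 = contradiction refl c≢0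
  countᵇ≢0⇒Any p (x ∷ xs) c≢0 with p x in px
  ... | true = here (from T-≡ px)
  ... | false = there (countᵇ≢0⇒Any p xs c≢0)

  countᵇ-≤-∑ : ∀ {k} (p : A → Bool) (q : Fin k → A → Bool) →
    (∀ x → T (p x) → ∃ λ j → T (q j x)) →
    ∀ xs → countᵇ p xs ≤ ∑[ j < k ] countᵇ (q j) xs
  countᵇ-≤-∑ {k} p q cover [] = ≤-reflexive (sym (sum-replicate-zero k))
  countᵇ-≤-∑ {k} p q cover (x ∷ xs) = begin
    countᵇ p (x ∷ xs)
      ≡⟨ countᵇ-∷ p x xs ⟩
    (if p x then 1 else 0) + countᵇ p xs
      ≤⟨ +-mono-≤ head≤ (countᵇ-≤-∑ p q cover xs) ⟩
    ∑[ j < k ] (if q j x then 1 else 0) + ∑[ j < k ] countᵇ (q j) xs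
      ≡⟨ ∑-distrib-+ (λ j → if q j x then 1 else 0) (λ j → countᵇ (q j) xs) ⟨
    ∑[ j < k ] ((if q j x then 1 else 0) + countᵇ (q j) xs)
      ≡⟨ sum-cong-≗ (λ j → countᵇ-∷ (q j) x xs) ⟨
    ∑[ j < k ] countᵇ (q j) (x ∷ xs) ∎
    where
    open ≤-Reasoning
    head≤ : (if p x then 1 else 0) ≤ ∑[ j < k ] (if q j x then 1 else 0)
    head≤ with p x in px
    ... | false = z≤n
    ... | true with cover x (from T-≡ px)
    ...   | j , qjx =
      ≤-trans (≤-reflexive (cong (λ b → if b then 1 else 0) (sym (to T-≡ qjx)))) (term≤∑ _ j)

incident⇒∈vertices : ∀ {n d} {z : Point n d} {e E} → e ∈ E → T (incidentᵇ z e) → z ∈ vertices E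
incident⇒∈vertices {z = z} {x , y} (here refl) inc with z ≟ₚ x
... | yes refl = here refl
... | no _ with z ≟ₚ y
...   | yes refl = there (here refl)
incident⇒∈vertices {E = _ ∷ _} (there e∈E) inc = there (there (incident⇒∈vertices e∈E inc))

module _ {n d : ℕ} (f : Point n d → Bool) where

  -- Φ f E χ z counts, definitionally, the coordinates i with anyᵇ (contributes χ z i) E.
  contributes : Coloring n d → Point n d → Fin d → Edge n d → Bool
  contributes χ z i e =
    if isIEdgeᵇ i e then (if incidentᵇ z e then ⌊ χ e BoolP.≟ f z ⌋ else false) else false

  contributes-cong : ∀ χ χ′ z i e → χ e ≡ χ′ e → contributes χ z i e ≡ contributes χ′ z i e
  contributes-cong χ χ′ z i e χe≡χ′e =
    cong (λ c → if isIEdgeᵇ i e then (if incidentᵇ z e then ⌊ c BoolP.≟ f z ⌋ else false) else false)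
         χe≡χ′e

  contributes⇒incident : ∀ χ z i e → T (contributes χ z i e) → T (incidentᵇ z e)
  contributes⇒incident χ z i e c with isIEdgeᵇ i e | incidentᵇ z e
  ... | true | true = tt

  Φ≢0⇒∈vertexSet : ∀ E χ z → Φ f E χ z ≢ 0 → z ∈ vertexSet E
  Φ≢0⇒∈vertexSet E χ z Φ≢0 with satisfied (countᵇ≢0⇒Any _ (allFin d) Φ≢0)
  ... | i , used with find (anyᵇ⇒Any (contributes χ z i) E used)
  ...   | e , e∈E , c =
    ∈-deduplicate⁺ _≟ₚ_ (incident⇒∈vertices e∈E (contributes⇒incident χ z i e c))

  Φ-≤-∑ : ∀ {k} E (Hs : Fin k → List (Edge n d)) χ (χs : Fin k → Coloring n d) →
    (∀ {e} → e ∈ E → ∃ λ j → e ∈ Hs j × χ e ≡ χs j e) →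
    ∀ z → Φ f E χ z ≤ ∑[ j < k ] Φ f (Hs j) (χs j) z
  Φ-≤-∑ E Hs χ χs covered z = countᵇ-≤-∑ _ _ witness (allFin d)
    where
    witness : ∀ i → T (anyᵇ (contributes χ z i) E) →
      ∃ λ j → T (anyᵇ (contributes (χs j) z i) (Hs j))
    witness i used with find (anyᵇ⇒Any (contributes χ z i) E used)
    ... | e , e∈E , c with covered e∈E
    ...   | j , e∈Hⱼ , χe≡χⱼe =
      j , Any⇒anyᵇ _ (lose e∈Hⱼ (subst T (contributes-cong χ (χs j) z i e χe≡χⱼe) c))

  SqrtSum≤-subadditive : ∀ {k} E (Hs : Fin k → List (Edge n d)) χ (χs : Fin k → Coloring n d) →
    (∀ {e} → e ∈ E → ∃ λ j → e ∈ Hs j × χ e ≡ χs j e) →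
    SqrtSum≤ (phiList f E χ) (concat (tabulate (λ j → phiList f (Hs j) (χs j))))
  SqrtSum≤-subadditive {k} E Hs χ χs covered N = begin
    scaledSqrtSum N (phiList f E χ)
      ≡⟨ cong sum (map-∘ V) ⟨
    sum (map (scaledSqrt N ∘ Φ f E χ) V)
      ≤⟨ sum-map-mono-≤ pointwise V ⟩
    sum (map (λ z → ∑[ j < k ] Φ⁺ j z) V)
      ≡⟨ sum-map-∑ Φ⁺ V ⟩
    ∑[ j < k ] sum (map (Φ⁺ j) V)
      ≤⟨ ∑-mono-≤ (λ j → sum-map-≤-unique (Φ⁺ j) (deduplicate-! _≟ₚ_ (vertices E)) (λ _ → support j)) ⟩
    ∑[ j < k ] sum (map (Φ⁺ j) (vertexSet (Hs j)))
      ≡⟨ sum-cong-≗ (λ j → cong sum (map-∘ (vertexSet (Hs j)))) ⟩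
    ∑[ j < k ] sum (map (scaledSqrt⁺ N) (phiList f (Hs j) (χs j)))
      ≡⟨ sum-map-concat-tabulate (scaledSqrt⁺ N) (λ j → phiList f (Hs j) (χs j)) ⟨
    sum (map (scaledSqrt⁺ N) B)
      ≤⟨ sum-map-mono-≤ (scaledSqrt⁺≤suc N) B ⟩
    sum (map (suc ∘ scaledSqrt N) B)
      ≡⟨ sum-map-suc (scaledSqrt N) B ⟩
    scaledSqrtSum N B + length B ∎
    where
    open ≤-Reasoning
    V = vertexSet E
    B = concat (tabulate (λ j → phiList f (Hs j) (χs j)))
    Φ⁺ : Fin k → Point n d → ℕ
    Φ⁺ j = scaledSqrt⁺ N ∘ Φ f (Hs j) (χs j)
    pointwise : ∀ z → scaledSqrt N (Φ f E χ z) ≤ ∑[ j < k ] Φ⁺ j z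
    pointwise z = ≤-trans (scaledSqrt-mono-≤ N (Φ-≤-∑ E Hs χ χs covered z))
                          (scaledSqrt-∑ N (λ j → Φ f (Hs j) (χs j) z))
    support : ∀ j {z} → Φ⁺ j z ≢ 0 → z ∈ vertexSet (Hs j)
    support j {z} Φ⁺≢0 =
      Φ≢0⇒∈vertexSet (Hs j) (χs j) z (λ Φ≡0 → Φ⁺≢0 (cong (scaledSqrt⁺ N) Φ≡0))

module _ {n d k : ℕ} (Hs : Fin k → List (Edge n d)) (χs : Fin k → Coloring n d) where
  open DecMembership (ProdP.≡-dec (_≟ₚ_ {n} {d}) (_≟ₚ_ {n} {d})) using (_∈?_)

  ∈-some? : ∀ e → Dec (∃ λ j → e ∈ Hs j)
  ∈-some? e = any? (λ j → e ∈? Hs j)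

  glue : Coloring n d
  glue e with ∈-some? e
  ... | yes (j , _) = χs j e
  ... | no _ = false

  glue-agrees : ∀ {e} → e ∈ concat (tabulate Hs) → ∃ λ j → e ∈ Hs j × glue e ≡ χs j e
  glue-agrees {e} e∈⋃Hs with ∈-some? e
  ... | yes (j , e∈Hⱼ) = j , e∈Hⱼ , refl
  ... | no e∉⋃Hs = contradiction (tabulate⁻ (∈-concat⁻ (tabulate Hs) e∈⋃Hs)) e∉⋃Hs

mainTheorem15 : (n d k : ℕ) (f : Point n d → Bool)
    (E : List (Edge n d)) (Hs : Fin k → List (Edge n d)) →
    IsViolationGraph f E →
    (∀ j → IsViolationGraph f (Hs j)) →
    E ↭ concat (tabulate Hs) →
    (χs : Fin k → Coloring n d) →
    Σ (Coloring n d) λ χ →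
      SqrtSum≤ (phiList f E χ) (concat (tabulate (λ j → phiList f (Hs j) (χs j))))
mainTheorem15 n d k f E Hs _ _ E↭⋃Hs χs =
  glue Hs χs , SqrtSum≤-subadditive f E Hs (glue Hs χs) χs (glue-agrees Hs χs ∘ ∈-resp-↭ E↭⋃Hs)
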